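{- Let $m,n \in \mathbb{N}^*$ with $n \geq 2$, and let $(x_d)_{d}$, indexed by the positive divisors $d$ of $n$ with $d \neq n$, be a family of nonnegative integers such that for every prime divisor $p$ of $n$, $$\sum_{d \mid n/p} x_d \leq m-1.$$ Then $$\sum_{d \mid n,\ d \neq n} \frac{x_d}{d} \leq m-1,$$ and this bound is best possible (it is attained for some such family). -}

module Defs where

open import Data.Nat using (ℕ; zero; suc; _+_)
open import Data.Nat.Divisibility using (_∣?_)
open import Data.Integer using (+_)
open import Data.Rational using (ℚ; _/_) renaming (_+_ to _+ℚ_; 0ℚ to 0ℚ)
open import Relation.Nullary using (yes; no)

divSumUpTo : ℕ → ℕ → (ℕ → ℕ) → ℕ
divSumUpTo zero    n x = 0
divSumUpTo (suc k) n x with suc k ∣? n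
... | yes _ = x (suc k) + divSumUpTo k n x
... | no  _ = divSumUpTo k n x

divSum : ℕ → (ℕ → ℕ) → ℕ
divSum n x = divSumUpTo n n x

divRecSumUpTo : ℕ → ℕ → (ℕ → ℕ) → ℚ
divRecSumUpTo zero    n x = 0ℚ
divRecSumUpTo (suc k) n x with suc k ∣? n
... | yes _ = ((+ x (suc k)) / suc k) +ℚ divRecSumUpTo k n x
... | no  _ = divRecSumUpTo k n x

properDivRecSum : ℕ → (ℕ → ℕ) → ℚ
properDivRecSum zero    x = 0ℚ
properDivRecSum (suc k) x = divRecSumUpTo k (suc k) x

module Submission where

-- Lemma 5.2.  Write S(q, x) = Σ_{d ∣ q} x_d and P(n, x) = Σ_{d ∣ n, d < n} x_d / d.
-- The upper bound P(n, x) ≤ M is proved for all rational families x ≥ 0 and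
-- bounds M by strong induction on n ≥ 2.  Write n = p k with p prime.  The
-- divisors of p k are the divisors of k together with the p e (e ∣ k, p e ∤ k),
-- which gives   P(p k, x) = Σ_{d ∣ k} x_d / d + (1/p) P(k, y'),
-- y'_e = [p e ∤ k] x_{pe}.  As 1/d ≤ 1/2 ≤ 1 - 1/p for d ≥ 2, the first sum
-- is at most (1 - 1/p) S(k, x) + (1/p) x_1, and S(k, x) ≤ M by hypothesis.
-- The family y = x_1 δ₁ + y' satisfies the hypothesis for k (S(q, y) ≤ S(p q, x)
-- for q ∣ k), so x_1 + P(k, y') = P(k, y) ≤ M by induction (for k = 1 simply
-- x_1 ≤ S(1, x) ≤ M).  Hence P(p k, x) ≤ (1 - 1/p) M + (1/p) M = M.
-- The bound is attained by x = (m - 1) δ₁.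

open import Defs
open import Data.Nat using (ℕ; _≤_; _*_; _∸_)
open import Data.Nat.Primality using (Prime)
open import Data.Product using (Σ; _×_)
open import Data.Integer using (+_)
open import Data.Rational using (_/_) renaming (_≤_ to _≤ℚ_)
open import Relation.Binary.PropositionalEquality using (_≡_)

open import Data.Nat as ℕ using (zero; suc; _<_; z≤n; s≤s; NonZero)
import Data.Nat.Properties as ℕₚ
open import Algebra.Properties.CommutativeSemigroup ℕₚ.*-commutativeSemigroup using (x∙yz≈y∙xz)
open import Data.Nat.Induction using (<-rec)
open import Data.Nat.Divisibility
  using (_∣_; _∣?_; divides; ∣⇒≤; ∣-trans; ∣-refl; 1∣_; n∣m*n; *-monoʳ-∣; *-cancelˡ-∣)
open import Data.Nat.Coprimality using (Coprime; coprime-divisor)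
open import Data.Nat.Primality using (prime⇒nonTrivial; prime⇒irreducible; ¬prime[0]; ¬prime[1])
open import Data.Nat.Primality.Factorisation using (factorise)
open import Data.Nat.ListAction using (product)
open import Data.List using ([]; _∷_)
open import Data.List.Relation.Unary.All using (_∷_)
import Data.Integer as ℤ
import Data.Integer.Properties as ℤₚ
open import Data.Rational using (ℚ; 0ℚ; 1ℚ; fromℚᵘ; nonNegative)
  renaming (_+_ to _+ℚ_; _*_ to _*ℚ_; _-_ to _-ℚ_)
import Data.Rational.Properties as ℚₚ
open import Data.Rational.Unnormalised as ℚᵘ using (mkℚᵘ; *≡*; *≤*)
import Data.Rational.Unnormalised.Properties as ℚᵘₚ
open import Data.Rational.Solver using (module +-*-Solver)
open import Algebra.Properties.Group ℚₚ.+-0-group using (∙-cancelˡ)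
open import Data.Product using (_,_; ∃₂)
open import Data.Sum using (inj₁; inj₂)
open import Data.Empty using (⊥-elim)
open import Function using (_∘_)
open import Relation.Nullary using (Dec; yes; no; ¬_; contradiction)
open import Relation.Binary.PropositionalEquality
  using (refl; sym; trans; cong; cong₂; subst; module ≡-Reasoning)

open +-*-Solver using (solve; _:+_; _:*_; _:-_; _:=_; con)

-- fromℚᵘ is a monotone semiring homomorphism; every cast fact below is
-- reduced through it to a computation on unnormalised fractions.
fromℚᵘ-homo-+ : ∀ p q → fromℚᵘ (p ℚᵘ.+ q) ≡ fromℚᵘ p +ℚ fromℚᵘ q
fromℚᵘ-homo-+ p q = ℚₚ.toℚᵘ-injective (ℚᵘₚ.≃-trans (ℚₚ.toℚᵘ-fromℚᵘ (p ℚᵘ.+ q))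
  (ℚᵘₚ.≃-trans (ℚᵘₚ.+-cong (ℚᵘₚ.≃-sym (ℚₚ.toℚᵘ-fromℚᵘ p)) (ℚᵘₚ.≃-sym (ℚₚ.toℚᵘ-fromℚᵘ q)))
               (ℚᵘₚ.≃-sym (ℚₚ.toℚᵘ-homo-+ (fromℚᵘ p) (fromℚᵘ q)))))

fromℚᵘ-homo-* : ∀ p q → fromℚᵘ (p ℚᵘ.* q) ≡ fromℚᵘ p *ℚ fromℚᵘ q
fromℚᵘ-homo-* p q = ℚₚ.toℚᵘ-injective (ℚᵘₚ.≃-trans (ℚₚ.toℚᵘ-fromℚᵘ (p ℚᵘ.* q))
  (ℚᵘₚ.≃-trans (ℚᵘₚ.*-cong (ℚᵘₚ.≃-sym (ℚₚ.toℚᵘ-fromℚᵘ p)) (ℚᵘₚ.≃-sym (ℚₚ.toℚᵘ-fromℚᵘ q)))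
               (ℚᵘₚ.≃-sym (ℚₚ.toℚᵘ-homo-* (fromℚᵘ p) (fromℚᵘ q)))))

fromℚᵘ-mono-≤ : ∀ {p q} → p ℚᵘ.≤ q → fromℚᵘ p ≤ℚ fromℚᵘ q
fromℚᵘ-mono-≤ {p} {q} p≤q = ℚₚ.toℚᵘ-cancel-≤
  (ℚᵘₚ.≤-respʳ-≃ (ℚᵘₚ.≃-sym (ℚₚ.toℚᵘ-fromℚᵘ q)) (ℚᵘₚ.≤-respˡ-≃ (ℚᵘₚ.≃-sym (ℚₚ.toℚᵘ-fromℚᵘ p)) p≤q))

-- The embedding ℕ → ℚ, written exactly as in the statement.
toℚ : ℕ → ℚ
toℚ a = (+ a) / 1

-- 1/d, with the harmless convention 1/0 = 0.
recip : ℕ → ℚ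
recip zero    = 0ℚ
recip (suc d) = (+ 1) / suc d

toℚ-homo-+ : ∀ a b → toℚ (a ℕ.+ b) ≡ toℚ a +ℚ toℚ b
toℚ-homo-+ a b = trans
  (ℚₚ.fromℚᵘ-cong {mkℚᵘ (+ (a ℕ.+ b)) 0} {mkℚᵘ (+ a) 0 ℚᵘ.+ mkℚᵘ (+ b) 0}
    (*≡* (cong (ℤ._* + 1) (cong₂ ℤ._+_ (sym (ℤₚ.*-identityʳ (+ a))) (sym (ℤₚ.*-identityʳ (+ b)))))))
  (fromℚᵘ-homo-+ (mkℚᵘ (+ a) 0) (mkℚᵘ (+ b) 0))

toℚ-mono-≤ : ∀ {a b} → a ≤ b → toℚ a ≤ℚ toℚ b
toℚ-mono-≤ {a} {b} a≤b = fromℚᵘ-mono-≤ {mkℚᵘ (+ a) 0} {mkℚᵘ (+ b) 0}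
  (*≤* (ℤₚ.*-monoʳ-≤-nonNeg (+ 1) (ℤ.+≤+ a≤b)))

toℚ-nonNeg : ∀ a → 0ℚ ≤ℚ toℚ a
toℚ-nonNeg a = toℚ-mono-≤ {0} {a} z≤n

recip-nonNeg : ∀ d → 0ℚ ≤ℚ recip d
recip-nonNeg zero    = ℚₚ.≤-refl
recip-nonNeg (suc d) = fromℚᵘ-mono-≤ {ℚᵘ.0ℚᵘ} {mkℚᵘ (+ 1) d} (*≤* (ℤ.+≤+ z≤n))

recip-≤-half : ∀ d → recip (suc (suc d)) ≤ℚ recip 2
recip-≤-half d = fromℚᵘ-mono-≤ {mkℚᵘ (+ 1) (suc d)} {mkℚᵘ (+ 1) 1} (*≤* (ℤ.+≤+ (s≤s (s≤s z≤n))))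

recip-prime-≤-half : ∀ {p} → Prime p → recip p ≤ℚ recip 2
recip-prime-≤-half {zero}          pr = ⊥-elim (¬prime[0] pr)
recip-prime-≤-half {suc zero}      pr = ⊥-elim (¬prime[1] pr)
recip-prime-≤-half {suc (suc p'')} pr = recip-≤-half p''

half-≤-complement : ∀ {c} → c ≤ℚ recip 2 → recip 2 ≤ℚ 1ℚ -ℚ c
half-≤-complement c≤½ = ℚₚ.+-monoʳ-≤ 1ℚ (ℚₚ.neg-antimono-≤ c≤½)

toℚ-/ : ∀ a d → (+ a) / suc d ≡ toℚ a *ℚ recip (suc d)
toℚ-/ a d = trans (ℚₚ.fromℚᵘ-cong {mkℚᵘ (+ a) d} {mkℚᵘ (+ a) 0 ℚᵘ.* mkℚᵘ (+ 1) d}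
                    (*≡* (cong₂ ℤ._*_ (sym (ℤₚ.*-identityʳ (+ a))) (cong (λ e → + suc e) (ℕₚ.+-identityʳ d)))))
                  (fromℚᵘ-homo-* (mkℚᵘ (+ a) 0) (mkℚᵘ (+ 1) d))

recip-homo-* : ∀ p e → recip (p * e) ≡ recip p *ℚ recip e
recip-homo-* zero    e       = sym (ℚₚ.*-zeroˡ (recip e))
recip-homo-* (suc p) zero    = trans (cong recip (ℕₚ.*-zeroʳ p)) (sym (ℚₚ.*-zeroʳ (recip (suc p))))
recip-homo-* (suc p) (suc e) = trans
  (ℚₚ.fromℚᵘ-cong {mkℚᵘ (+ 1) (e ℕ.+ p * suc e)} {mkℚᵘ (+ 1) p ℚᵘ.* mkℚᵘ (+ 1) e} (*≡* refl))
  (fromℚᵘ-homo-* (mkℚᵘ (+ 1) p) (mkℚᵘ (+ 1) e))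

sumTo : ℕ → (ℕ → ℚ) → ℚ
sumTo zero    f = 0ℚ
sumTo (suc N) f = f (suc N) +ℚ sumTo N f

sumTo-cong : ∀ N {f g : ℕ → ℚ} → (∀ d → f (suc d) ≡ g (suc d)) → sumTo N f ≡ sumTo N g
sumTo-cong zero    f≡g = refl
sumTo-cong (suc N) f≡g = cong₂ _+ℚ_ (f≡g N) (sumTo-cong N f≡g)

sumTo-mono : ∀ N {f g : ℕ → ℚ} → (∀ d → f (suc d) ≤ℚ g (suc d)) → sumTo N f ≤ℚ sumTo N g
sumTo-mono zero    f≤g = ℚₚ.≤-refl
sumTo-mono (suc N) f≤g = ℚₚ.+-mono-≤ (f≤g N) (sumTo-mono N f≤g)

sumTo-+ : ∀ N (f g : ℕ → ℚ) → sumTo N (λ d → f d +ℚ g d) ≡ sumTo N f +ℚ sumTo N g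
sumTo-+ zero    f g = refl
sumTo-+ (suc N) f g = trans (cong (f (suc N) +ℚ g (suc N) +ℚ_) (sumTo-+ N f g))
                            (interchange (f (suc N)) (g (suc N)) (sumTo N f) (sumTo N g))
  where
  interchange : ∀ a b c d → (a +ℚ b) +ℚ (c +ℚ d) ≡ (a +ℚ c) +ℚ (b +ℚ d)
  interchange = solve 4 (λ a b c d → (a :+ b) :+ (c :+ d) := (a :+ c) :+ (b :+ d)) refl

sumTo-scale : ∀ N c (f : ℕ → ℚ) → sumTo N (λ d → c *ℚ f d) ≡ c *ℚ sumTo N f
sumTo-scale zero    c f = sym (ℚₚ.*-zeroʳ c)
sumTo-scale (suc N) c f = trans (cong (c *ℚ f (suc N) +ℚ_) (sumTo-scale N c f))
                                (sym (ℚₚ.*-distribˡ-+ c (f (suc N)) (sumTo N f)))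

sumTo-skip : ∀ K j {f : ℕ → ℚ} → (∀ d → K < d → d ≤ K ℕ.+ j → f d ≡ 0ℚ) → sumTo (K ℕ.+ j) f ≡ sumTo K f
sumTo-skip K zero    {f} f≡0 = cong (λ N → sumTo N f) (ℕₚ.+-identityʳ K)
sumTo-skip K (suc j) {f} f≡0 = begin
  sumTo (K ℕ.+ suc j) f            ≡⟨ cong (λ N → sumTo N f) (ℕₚ.+-suc K j) ⟩
  f (suc (K ℕ.+ j)) +ℚ sumTo (K ℕ.+ j) f
    ≡⟨ cong₂ _+ℚ_ (f≡0 _ (s≤s (ℕₚ.m≤m+n K j)) (ℕₚ.≤-reflexive (sym (ℕₚ.+-suc K j))))
                  (sumTo-skip K j (λ d K<d d≤ → f≡0 d K<d (ℕₚ.≤-trans d≤ (ℕₚ.+-monoʳ-≤ K (ℕₚ.n≤1+n j))))) ⟩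
  0ℚ +ℚ sumTo K f                  ≡⟨ ℚₚ.+-identityˡ (sumTo K f) ⟩
  sumTo K f                        ∎
  where open ≡-Reasoning

no-multiple-between : ∀ p N {d} → p * N < d → d < p * suc N → ¬ (p ∣ d)
no-multiple-between p N {d} pN<d d<pN+p (divides q d≡qp) =
  ℕₚ.<⇒≱ (ℕₚ.*-cancelˡ-< p N q pN<pq) (ℕₚ.≤-pred (ℕₚ.*-cancelˡ-< p q (suc N) pq<pN+p))
  where
  d≡pq : d ≡ p * q
  d≡pq = trans d≡qp (ℕₚ.*-comm q p)
  pN<pq : p * N < p * q
  pN<pq = subst (p * N <_) d≡pq pN<d
  pq<pN+p : p * q < p * suc N
  pq<pN+p = subst (_< p * suc N) d≡pq d<pN+p

sumTo-multiples : ∀ p' N {f : ℕ → ℚ} → (∀ d → ¬ (suc p' ∣ d) → f d ≡ 0ℚ) →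
                  sumTo (suc p' * N) f ≡ sumTo N (λ e → f (suc p' * e))
sumTo-multiples p' zero    {f} f≡0 = cong (λ M → sumTo M f) (ℕₚ.*-zeroʳ p')
sumTo-multiples p' (suc N) {f} f≡0 = begin
  sumTo (p * suc N) f                       ≡⟨ cong (λ M → sumTo M f) p[N+1]≡ ⟩
  f (suc (p * N ℕ.+ p')) +ℚ sumTo (p * N ℕ.+ p') f
    ≡⟨ cong₂ _+ℚ_ (cong f (sym p[N+1]≡)) (sumTo-skip (p * N) p' (λ d pN<d d≤ →
         f≡0 d (no-multiple-between p N pN<d (subst (d <_) (sym p[N+1]≡) (s≤s d≤))))) ⟩
  f (p * suc N) +ℚ sumTo (p * N) f          ≡⟨ cong (f (p * suc N) +ℚ_) (sumTo-multiples p' N f≡0) ⟩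
  sumTo (suc N) (λ e → f (p * e))           ∎
  where
  open ≡-Reasoning
  p = suc p'
  p[N+1]≡ : p * suc N ≡ suc (p * N ℕ.+ p')
  p[N+1]≡ = trans (ℕₚ.*-suc p N) (cong suc (ℕₚ.+-comm p' (p * N)))

atOne : ℚ → ℕ → ℚ
atOne c 1 = c
atOne c _ = 0ℚ

sumTo-atOne : ∀ N c → sumTo (suc N) (atOne c) ≡ c
sumTo-atOne zero    c = ℚₚ.+-identityʳ c
sumTo-atOne (suc N) c = trans (ℚₚ.+-identityˡ _) (sumTo-atOne N c)

when : ∀ {P : Set} → Dec P → ℚ → ℚ
when (yes _) v = v
when (no _)  v = 0ℚ

unless : ∀ {P : Set} → Dec P → ℚ → ℚ
unless (yes _) v = 0ℚ
unless (no _)  v = v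

module _ {P : Set} where

  when-true : (D : Dec P) {v : ℚ} → P → when D v ≡ v
  when-true (yes _) _ = refl
  when-true (no ¬p) p = contradiction p ¬p

  unless-false : (D : Dec P) {v : ℚ} → ¬ P → unless D v ≡ v
  unless-false (yes p) ¬p = contradiction p ¬p
  unless-false (no _)  ¬p = refl

  when-0 : (D : Dec P) → when D 0ℚ ≡ 0ℚ
  when-0 (yes _) = refl
  when-0 (no _)  = refl

  when-cong : (D : Dec P) {u v : ℚ} → (P → u ≡ v) → when D u ≡ when D v
  when-cong (yes p) u≡v = u≡v p
  when-cong (no _)  u≡v = refl

  when-mono : (D : Dec P) {u v : ℚ} → (P → u ≤ℚ v) → when D u ≤ℚ when D v
  when-mono (yes p) u≤v = u≤v p
  when-mono (no _)  u≤v = ℚₚ.≤-refl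

  when-+ : (D : Dec P) (u v : ℚ) → when D (u +ℚ v) ≡ when D u +ℚ when D v
  when-+ (yes _) u v = refl
  when-+ (no _)  u v = sym (ℚₚ.+-identityˡ 0ℚ)

  when-scale : (D : Dec P) (c v : ℚ) → when D (c *ℚ v) ≡ c *ℚ when D v
  when-scale (yes _) c v = refl
  when-scale (no _)  c v = sym (ℚₚ.*-zeroʳ c)

  unless-nonNeg : (D : Dec P) {v : ℚ} → 0ℚ ≤ℚ v → 0ℚ ≤ℚ unless D v
  unless-nonNeg (yes _) _   = ℚₚ.≤-refl
  unless-nonNeg (no _)  0≤v = 0≤v

divSumTo : ℕ → ℕ → (ℕ → ℚ) → ℚ
divSumTo N n f = sumTo N (λ d → when (d ∣? n) (f d))

divisorSum : ℕ → (ℕ → ℚ) → ℚ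
divisorSum n = divSumTo n n

properDivisorSum : ℕ → (ℕ → ℚ) → ℚ
properDivisorSum n = divSumTo (n ∸ 1) n

module _ (N n : ℕ) where

  divSumTo-cong : {f g : ℕ → ℚ} → (∀ d → suc d ∣ n → f (suc d) ≡ g (suc d)) →
                  divSumTo N n f ≡ divSumTo N n g
  divSumTo-cong f≡g = sumTo-cong N (λ d → when-cong (suc d ∣? n) (f≡g d))

  divSumTo-mono : {f g : ℕ → ℚ} → (∀ d → suc d ∣ n → f (suc d) ≤ℚ g (suc d)) →
                  divSumTo N n f ≤ℚ divSumTo N n g
  divSumTo-mono f≤g = sumTo-mono N (λ d → when-mono (suc d ∣? n) (f≤g d))

  divSumTo-+ : (f g : ℕ → ℚ) → divSumTo N n (λ d → f d +ℚ g d) ≡ divSumTo N n f +ℚ divSumTo N n g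
  divSumTo-+ f g = trans (sumTo-cong N (λ d → when-+ (suc d ∣? n) (f (suc d)) (g (suc d))))
                         (sumTo-+ N (λ d → when (d ∣? n) (f d)) (λ d → when (d ∣? n) (g d)))

  divSumTo-scale : (c : ℚ) (f : ℕ → ℚ) → divSumTo N n (λ d → c *ℚ f d) ≡ c *ℚ divSumTo N n f
  divSumTo-scale c f = trans (sumTo-cong N (λ d → when-scale (suc d ∣? n) c (f (suc d))))
                             (sumTo-scale N c (λ d → when (d ∣? n) (f d)))

divSumTo-atOne : ∀ N n c → divSumTo (suc N) n (atOne c) ≡ c
divSumTo-atOne N n c = trans (sumTo-cong (suc N) {f = λ d → when (d ∣? n) (atOne c d)} {g = atOne c} pointwise) (sumTo-atOne N c)
  where
  pointwise : ∀ d → when (suc d ∣? n) (atOne c (suc d)) ≡ atOne c (suc d)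
  pointwise zero    = when-true (1 ∣? n) (1∣ n)
  pointwise (suc d) = when-0 (suc (suc d) ∣? n)

divisorSum-top : ∀ n (f : ℕ → ℚ) → divisorSum (suc n) f ≡ f (suc n) +ℚ properDivisorSum (suc n) f
divisorSum-top n f = cong (_+ℚ properDivisorSum (suc n) f) (when-true (suc n ∣? suc n) ∣-refl)

prime∣new-divisor : ∀ {p d k} → Prime p → d ∣ p * k → ¬ (d ∣ k) → p ∣ d
prime∣new-divisor {p} {d} pr d∣pk d∤k with p ∣? d
... | yes p∣d = p∣d
... | no  p∤d = contradiction (coprime-divisor d⊥p d∣pk) d∤k
  where
  d⊥p : Coprime d p
  d⊥p (i∣d , i∣p) with prime⇒irreducible pr i∣p
  ... | inj₁ i≡1 = i≡1
  ... | inj₂ i≡p = contradiction (subst (_∣ d) i≡p i∣d) p∤d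

cofactor-< : ∀ {p} k .{{_ : NonZero k}} → Prime p → k < p * k
cofactor-< {p} k pr = subst (k <_) (ℕₚ.*-comm k p) (ℕₚ.m<m*n k p (ℕ.nonTrivial⇒n>1 p {{prime⇒nonTrivial pr}}))

newPart : ℕ → ℕ → (ℕ → ℚ) → ℕ → ℚ
newPart p k x e = unless (p * e ∣? k) (x (p * e))

-- Σ_{d ∣ p k} f(d) = Σ_{d ∣ k} f(d) + Σ_{e ∣ k} [p e ∤ k] f(p e):
-- the divisors of p k are those of k together with the p e, e ∣ k, p e ∤ k.
divisorSum-split : ∀ {p} k .{{_ : NonZero k}} (f : ℕ → ℚ) → Prime p →
  divisorSum (p * k) f ≡ divisorSum k f +ℚ divisorSum k (newPart p k f)
divisorSum-split {zero}   k f pr = ⊥-elim (¬prime[0] pr)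
divisorSum-split {suc p'} k f pr = begin
  divisorSum (p * k) f                                 ≡⟨ sumTo-cong (p * k) (λ d → split (suc d)) ⟩
  sumTo (p * k) (λ d → when (d ∣? k) (f d) +ℚ new d)   ≡⟨ sumTo-+ (p * k) (λ d → when (d ∣? k) (f d)) new ⟩
  divSumTo (p * k) k f +ℚ sumTo (p * k) new
    ≡⟨ cong₂ _+ℚ_ (sumTo-skip k (p' * k) beyond-k) (sumTo-multiples p' k new-off-multiples) ⟩
  divisorSum k f +ℚ sumTo k (λ e → new (p * e))        ≡⟨ cong (divisorSum k f +ℚ_) (sumTo-cong k (λ e → new-at-multiple (suc e))) ⟩
  divisorSum k f +ℚ divisorSum k (newPart p k f)       ∎
  where
  open ≡-Reasoning
  p = suc p'

  new : ℕ → ℚ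
  new d = when (d ∣? p * k) (unless (d ∣? k) (f d))

  split : ∀ d → when (d ∣? p * k) (f d) ≡ when (d ∣? k) (f d) +ℚ new d
  split d with d ∣? k | d ∣? p * k
  ... | yes _   | yes _    = sym (ℚₚ.+-identityʳ (f d))
  ... | yes d∣k | no  d∤pk = contradiction (∣-trans d∣k (n∣m*n p)) d∤pk
  ... | no  _   | yes _    = sym (ℚₚ.+-identityˡ (f d))
  ... | no  _   | no  _    = sym (ℚₚ.+-identityˡ 0ℚ)

  beyond-k : ∀ d → k < d → d ≤ k ℕ.+ p' * k → when (d ∣? k) (f d) ≡ 0ℚ
  beyond-k d k<d _ with d ∣? k
  ... | yes d∣k = contradiction (∣⇒≤ d∣k) (ℕₚ.<⇒≱ k<d)
  ... | no  _   = refl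

  new-off-multiples : ∀ d → ¬ (p ∣ d) → new d ≡ 0ℚ
  new-off-multiples d p∤d with d ∣? p * k | d ∣? k
  ... | yes d∣pk | no d∤k = contradiction (prime∣new-divisor pr d∣pk d∤k) p∤d
  ... | yes _    | yes _  = refl
  ... | no  _    | _      = refl

  new-at-multiple : ∀ e → new (p * e) ≡ when (e ∣? k) (newPart p k f e)
  new-at-multiple e with p * e ∣? p * k | e ∣? k
  ... | yes _     | yes _   = refl
  ... | yes pe∣pk | no  e∤k = contradiction (*-cancelˡ-∣ p pe∣pk) e∤k
  ... | no  pe∤pk | yes e∣k = contradiction (*-monoʳ-∣ p e∣k) pe∤pk
  ... | no  _     | no  _   = refl

-- The same splitting for proper divisors: the top divisor p k of the left
-- corresponds to the top divisor k of the last sum.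
properDivisorSum-split : ∀ {p} k .{{_ : NonZero k}} (f : ℕ → ℚ) → Prime p →
  properDivisorSum (p * k) f ≡ divisorSum k f +ℚ properDivisorSum k (newPart p k f)
properDivisorSum-split {zero}          k       f pr = ⊥-elim (¬prime[0] pr)
properDivisorSum-split {suc zero}      k       f pr = ⊥-elim (¬prime[1] pr)
properDivisorSum-split {p@(suc (suc _))} (suc k') f pr = ∙-cancelˡ (f (p * k)) _ _ (begin
  -- p k is suc (k' + (p - 1) k) by definition
  f (p * k) +ℚ properDivisorSum (p * k) f              ≡⟨ divisorSum-top (k' ℕ.+ (p ∸ 1) * k) f ⟨
  divisorSum (p * k) f                                 ≡⟨ divisorSum-split k f pr ⟩
  divisorSum k f +ℚ divisorSum k g                     ≡⟨ cong (divisorSum k f +ℚ_) (divisorSum-top k' g) ⟩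
  divisorSum k f +ℚ (g k +ℚ properDivisorSum k g)      ≡⟨ cong (λ t → divisorSum k f +ℚ (t +ℚ properDivisorSum k g)) g[k]≡ ⟩
  divisorSum k f +ℚ (f (p * k) +ℚ properDivisorSum k g) ≡⟨ swap (divisorSum k f) (f (p * k)) (properDivisorSum k g) ⟩
  f (p * k) +ℚ (divisorSum k f +ℚ properDivisorSum k g) ∎)
  where
  open ≡-Reasoning
  k = suc k'
  g = newPart p k f

  g[k]≡ : g k ≡ f (p * k)
  g[k]≡ = unless-false (p * k ∣? k) (λ pk∣k → ℕₚ.<⇒≱ (cofactor-< k pr) (∣⇒≤ pk∣k))

  swap : ∀ a b c → a +ℚ (b +ℚ c) ≡ b +ℚ (a +ℚ c)
  swap = solve 3 (λ a b c → a :+ (b :+ c) := b :+ (a :+ c)) refl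

weighted : (ℕ → ℚ) → ℕ → ℚ
weighted x d = x d *ℚ recip d

NonNeg : (ℕ → ℚ) → Set
NonNeg x = ∀ d → 0ℚ ≤ℚ x d

Bounded : ℕ → (ℕ → ℚ) → ℚ → Set
Bounded n x M = ∀ p q → Prime p → n ≡ p * q → divisorSum q x ≤ℚ M

UpperBound : ℚ → ℕ → Set
UpperBound M n = ∀ x → NonNeg x → Bounded n x M → properDivisorSum n (weighted x) ≤ℚ M

*-monoˡ-≤ : ∀ {r u v} → 0ℚ ≤ℚ r → u ≤ℚ v → r *ℚ u ≤ℚ r *ℚ v
*-monoˡ-≤ {r} 0≤r u≤v = ℚₚ.*-monoˡ-≤-nonNeg r {{nonNegative 0≤r}} u≤v

atOne-≤ : ∀ {x} → NonNeg x → ∀ d → atOne (x 1) d ≤ℚ x d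
atOne-≤ x≥0 zero          = x≥0 zero
atOne-≤ x≥0 (suc zero)    = ℚₚ.≤-refl
atOne-≤ x≥0 (suc (suc d)) = x≥0 (suc (suc d))

x₁-≤-divisorSum : ∀ {x} → NonNeg x → ∀ k' → x 1 ≤ℚ divisorSum (suc k') x
x₁-≤-divisorSum {x} x≥0 k' = subst (_≤ℚ divisorSum (suc k') x) (divSumTo-atOne k' (suc k') (x 1))
  (divSumTo-mono (suc k') (suc k') (λ d _ → atOne-≤ x≥0 (suc d)))

-- For c ≤ 1/2:  Σ_{d ∣ k} x_d / d ≤ (1 - c) Σ_{d ∣ k} x_d + c x_1,
-- because 1/d ≤ 1/2 ≤ 1 - c for every d ≥ 2.
weightedBound : ∀ k' {c} {x} → c ≤ℚ recip 2 → NonNeg x →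
  divisorSum (suc k') (weighted x) ≤ℚ (1ℚ -ℚ c) *ℚ divisorSum (suc k') x +ℚ c *ℚ x 1
weightedBound k' {c} {x} c≤½ x≥0 = begin
  divisorSum k (weighted x)                              ≤⟨ divSumTo-mono k k (λ d _ → termwise d) ⟩
  divisorSum k (λ d → (1ℚ -ℚ c) *ℚ x d +ℚ c *ℚ atOne (x 1) d)
    ≡⟨ divSumTo-+ k k (λ d → (1ℚ -ℚ c) *ℚ x d) (λ d → c *ℚ atOne (x 1) d) ⟩
  divisorSum k (λ d → (1ℚ -ℚ c) *ℚ x d) +ℚ divisorSum k (λ d → c *ℚ atOne (x 1) d)
    ≡⟨ cong₂ _+ℚ_ (divSumTo-scale k k (1ℚ -ℚ c) x)
                  (trans (divSumTo-scale k k c (atOne (x 1))) (cong (c *ℚ_) (divSumTo-atOne k' k (x 1)))) ⟩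
  (1ℚ -ℚ c) *ℚ divisorSum k x +ℚ c *ℚ x 1             ∎
  where
  open ℚₚ.≤-Reasoning
  k = suc k'

  termwise : ∀ d → weighted x (suc d) ≤ℚ (1ℚ -ℚ c) *ℚ x (suc d) +ℚ c *ℚ atOne (x 1) (suc d)
  termwise zero    = ℚₚ.≤-reflexive (split-unit (x 1) c)
    where
    split-unit : ∀ v c → v *ℚ 1ℚ ≡ (1ℚ -ℚ c) *ℚ v +ℚ c *ℚ v
    split-unit = solve 2 (λ v c → v :* con 1ℚ := (con 1ℚ :- c) :* v :+ c :* v) refl
  termwise (suc d) = begin
    x (2+d) *ℚ recip (2+d)              ≤⟨ *-monoˡ-≤ (x≥0 (2+d)) (ℚₚ.≤-trans (recip-≤-half d) (half-≤-complement c≤½)) ⟩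
    x (2+d) *ℚ (1ℚ -ℚ c)                ≡⟨ rearrange (x (2+d)) c ⟩
    (1ℚ -ℚ c) *ℚ x (2+d) +ℚ c *ℚ 0ℚ     ∎
    where
    2+d = suc (suc d)
    rearrange : ∀ v c → v *ℚ (1ℚ -ℚ c) ≡ (1ℚ -ℚ c) *ℚ v +ℚ c *ℚ 0ℚ
    rearrange = solve 2 (λ v c → v :* (con 1ℚ :- c) := (con 1ℚ :- c) :* v :+ c :* con 0ℚ) refl

inherited : ℕ → ℕ → (ℕ → ℚ) → ℕ → ℚ
inherited p k x e = atOne (x 1) e +ℚ newPart p k x e

weighted-split : ∀ {p} k .{{_ : NonZero k}} (x : ℕ → ℚ) → Prime p →
  properDivisorSum (p * k) (weighted x) ≡
  divisorSum k (weighted x) +ℚ recip p *ℚ properDivisorSum k (weighted (newPart p k x))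
weighted-split {p} k x pr = trans (properDivisorSum-split k (weighted x) pr)
  (cong (divisorSum k (weighted x) +ℚ_)
    (trans (divSumTo-cong (k ∸ 1) k (λ e _ → factor (suc e)))
           (divSumTo-scale (k ∸ 1) k (recip p) (weighted (newPart p k x)))))
  where
  factor : ∀ e → unless (p * e ∣? k) (weighted x (p * e)) ≡ recip p *ℚ weighted (newPart p k x) e
  factor e with p * e ∣? k
  ... | yes _ = solve 2 (λ a b → con 0ℚ := a :* (con 0ℚ :* b)) refl (recip p) (recip e)
  ... | no  _ = trans (cong (x (p * e) *ℚ_) (recip-homo-* p e))
                      (solve 3 (λ v a b → v :* (a :* b) := a :* (v :* b)) refl (x (p * e)) (recip p) (recip e))

inherited-nonNeg : ∀ p k {x} → NonNeg x → NonNeg (inherited p k x)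
inherited-nonNeg p k x≥0 e = ℚₚ.+-mono-≤ (atOne-nonNeg e) (unless-nonNeg (p * e ∣? k) (x≥0 (p * e)))
  where
  atOne-nonNeg : ∀ e → 0ℚ ≤ℚ atOne _ e
  atOne-nonNeg zero          = ℚₚ.≤-refl
  atOne-nonNeg (suc zero)    = x≥0 1
  atOne-nonNeg (suc (suc _)) = ℚₚ.≤-refl

-- For q ∣ k:  Σ_{e ∣ q} y_e ≤ Σ_{d ∣ p q} x_d  (y the inherited family),
-- since x_1 ≤ Σ_{d ∣ q} x_d and p e ∤ k implies p e ∤ q.
inherited-divisorSum : ∀ {p} k q' {x} → Prime p → NonNeg x → suc q' ∣ k →
  divisorSum (suc q') (inherited p k x) ≤ℚ divisorSum (p * suc q') x
inherited-divisorSum {p} k q' {x} pr x≥0 q∣k = begin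
  divisorSum q (inherited p k x)                        ≡⟨ divSumTo-+ q q (atOne (x 1)) (newPart p k x) ⟩
  divisorSum q (atOne (x 1)) +ℚ divisorSum q (newPart p k x)
    ≤⟨ ℚₚ.+-mono-≤ (ℚₚ.≤-reflexive (divSumTo-atOne q' q (x 1))) (divSumTo-mono q q (λ e _ → fewer-new (suc e))) ⟩
  x 1 +ℚ divisorSum q (newPart p q x)                   ≤⟨ ℚₚ.+-monoˡ-≤ _ (x₁-≤-divisorSum x≥0 q') ⟩
  divisorSum q x +ℚ divisorSum q (newPart p q x)        ≡⟨ divisorSum-split q x pr ⟨
  divisorSum (p * q) x                                  ∎
  where
  open ℚₚ.≤-Reasoning
  q = suc q'
  fewer-new : ∀ e → newPart p k x e ≤ℚ newPart p q x e
  fewer-new e with p * e ∣? k | p * e ∣? q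
  ... | yes _   | D       = unless-nonNeg D (x≥0 (p * e))
  ... | no pe∤k | yes pe∣q = contradiction (∣-trans pe∣q q∣k) pe∤k
  ... | no _    | no _    = ℚₚ.≤-refl

-- The inherited family satisfies the hypothesis of the lemma for k:
-- for k = r q one compares with the hypothesis on p k = r (p q).
inherited-bounded : ∀ {p} k' {x M} → Prime p → NonNeg x → Bounded (p * suc k') x M →
  Bounded (suc k') (inherited p (suc k') x) M
inherited-bounded k' pr x≥0 bounded r zero     prr k≡r*0 = contradiction (trans k≡r*0 (ℕₚ.*-zeroʳ r)) (λ ())
inherited-bounded {p} k' pr x≥0 bounded r (suc q') prr k≡rq =
  ℚₚ.≤-trans (inherited-divisorSum (suc k') q' pr x≥0 (divides r k≡rq))
             (bounded r (p * suc q') prr (trans (cong (p *_) k≡rq) (x∙yz≈y∙xz p r (suc q'))))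

-- weighted is linear and fixes c·δ₁, so a nonempty divisor sum of the
-- weighted family c·δ₁ + f is c plus that of the weighted f.
divSumTo-weighted-atOne : ∀ N n c (f : ℕ → ℚ) →
  divSumTo (suc N) n (weighted (λ d → atOne c d +ℚ f d)) ≡ c +ℚ divSumTo (suc N) n (weighted f)
divSumTo-weighted-atOne N n c f = begin
  divSumTo (suc N) n (weighted (λ d → atOne c d +ℚ f d))  ≡⟨ divSumTo-cong (suc N) n (λ d _ → termwise d) ⟩
  divSumTo (suc N) n (λ d → atOne c d +ℚ weighted f d)     ≡⟨ divSumTo-+ (suc N) n (atOne c) (weighted f) ⟩
  divSumTo (suc N) n (atOne c) +ℚ divSumTo (suc N) n (weighted f)
    ≡⟨ cong (_+ℚ divSumTo (suc N) n (weighted f)) (divSumTo-atOne N n c) ⟩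
  c +ℚ divSumTo (suc N) n (weighted f)                      ∎
  where
  open ≡-Reasoning
  termwise : ∀ d → weighted (λ d → atOne c d +ℚ f d) (suc d) ≡ atOne c (suc d) +ℚ weighted f (suc d)
  termwise zero    = solve 2 (λ c v → (c :+ v) :* con 1ℚ := c :+ v :* con 1ℚ) refl c (f 1)
  termwise (suc d) = solve 2 (λ v r → (con 0ℚ :+ v) :* r := con 0ℚ :+ v :* r) refl (f (suc (suc d))) (recip (suc (suc d)))

-- x_1 + P(k, newPart) ≤ M.  For k = 1 the sum is empty and x_1 ≤ S(1, x) ≤ M;
-- for k ≥ 2 the left side is P(k, y) for the inherited family y, bounded
-- by the induction hypothesis.
newPart-bound : ∀ {p M} k' → Prime p → (2 ≤ suc k' → UpperBound M (suc k')) →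
  ∀ {x} → NonNeg x → Bounded (p * suc k') x M →
  x 1 +ℚ properDivisorSum (suc k') (weighted (newPart p (suc k') x)) ≤ℚ M
newPart-bound {p} zero pr ih {x} x≥0 bounded = begin
  x 1 +ℚ 0ℚ         ≡⟨ ℚₚ.+-identityʳ (x 1) ⟩
  x 1               ≤⟨ x₁-≤-divisorSum x≥0 0 ⟩
  divisorSum 1 x    ≤⟨ bounded p 1 pr refl ⟩
  _                 ∎
  where open ℚₚ.≤-Reasoning
newPart-bound {p} (suc k'') pr ih {x} x≥0 bounded = begin
  x 1 +ℚ properDivisorSum k (weighted (newPart p k x))  ≡⟨ divSumTo-weighted-atOne k'' k (x 1) (newPart p k x) ⟨
  properDivisorSum k (weighted (inherited p k x))
    ≤⟨ ih (s≤s (s≤s z≤n)) (inherited p k x) (inherited-nonNeg p k x≥0) (inherited-bounded (suc k'') pr x≥0 bounded) ⟩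
  _                                                     ∎
  where
  open ℚₚ.≤-Reasoning
  k = suc (suc k'')

-- The induction step: the bound for p k follows from the bound for k.
-- With c = 1/p ≤ 1/2 and Z = x_1 + P(k, newPart):
--   P(p k, x) ≤ (1 - c) S(k, x) + c Z ≤ (1 - c) M + c M = M.
primeStep : ∀ {p M} k' → Prime p → (2 ≤ suc k' → UpperBound M (suc k')) → UpperBound M (p * suc k')
primeStep {p} {M} k' pr ih x x≥0 bounded = begin
  properDivisorSum (p * k) (weighted x)                    ≡⟨ weighted-split k x pr ⟩
  divisorSum k (weighted x) +ℚ c *ℚ P                      ≤⟨ ℚₚ.+-monoˡ-≤ (c *ℚ P) (weightedBound k' c≤½ x≥0) ⟩
  ((1ℚ -ℚ c) *ℚ divisorSum k x +ℚ c *ℚ x 1) +ℚ c *ℚ P      ≡⟨ regroup ((1ℚ -ℚ c) *ℚ divisorSum k x) c (x 1) P ⟩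
  (1ℚ -ℚ c) *ℚ divisorSum k x +ℚ c *ℚ (x 1 +ℚ P)
    ≤⟨ ℚₚ.+-mono-≤ (*-monoˡ-≤ 0≤1-c (bounded p k pr refl))
                   (*-monoˡ-≤ (recip-nonNeg p) (newPart-bound k' pr ih x≥0 bounded)) ⟩
  (1ℚ -ℚ c) *ℚ M +ℚ c *ℚ M                                 ≡⟨ recombine c M ⟩
  M                                                        ∎
  where
  open ℚₚ.≤-Reasoning
  k = suc k'
  c = recip p
  P = properDivisorSum k (weighted (newPart p k x))

  c≤½ : c ≤ℚ recip 2
  c≤½ = recip-prime-≤-half pr

  0≤1-c : 0ℚ ≤ℚ 1ℚ -ℚ c
  0≤1-c = ℚₚ.≤-trans (recip-nonNeg 2) (half-≤-complement c≤½)

  regroup : ∀ a c v w → (a +ℚ c *ℚ v) +ℚ c *ℚ w ≡ a +ℚ c *ℚ (v +ℚ w)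
  regroup = solve 4 (λ a c v w → (a :+ c :* v) :+ c :* w := a :+ c :* (v :+ w)) refl

  recombine : ∀ c m → (1ℚ -ℚ c) *ℚ m +ℚ c *ℚ m ≡ m
  recombine = solve 2 (λ c m → (con 1ℚ :- c) :* m :+ c :* m := m) refl

primeFactor : ∀ n → 2 ≤ n → ∃₂ λ p k → Prime p × n ≡ p * k
primeFactor (suc zero)      (s≤s ())
primeFactor n@(suc (suc _)) _ with factorise n
... | record { factors = []     ; isFactorisation = () }
... | record { factors = p ∷ ps ; isFactorisation = n≡p*ps ; factorsPrime = p-prime ∷ _ } =
  p , product ps , p-prime , n≡p*ps

upperBound : ∀ M n → 2 ≤ n → UpperBound M n
upperBound M = <-rec (λ n → 2 ≤ n → UpperBound M n) step
  where
  step : ∀ n → (∀ {m} → m < n → 2 ≤ m → UpperBound M m) → 2 ≤ n → UpperBound M n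
  step n ih 2≤n with primeFactor n 2≤n
  ... | p , zero   , _  , n≡p*0 = contradiction (trans n≡p*0 (ℕₚ.*-zeroʳ p)) (ℕₚ.m<n⇒n≢0 2≤n)
  ... | p , suc k' , pr , n≡pk  =
    subst (UpperBound M) (sym n≡pk) (primeStep k' pr (ih k<n))
    where
    k<n : suc k' < n
    k<n = subst (suc k' <_) (sym n≡pk) (cofactor-< (suc k') pr)

divRecSumUpTo-≡ : ∀ N n x → divRecSumUpTo N n x ≡ divSumTo N n (weighted (toℚ ∘ x))
divRecSumUpTo-≡ zero    n x = refl
divRecSumUpTo-≡ (suc N) n x with suc N ∣? n
... | yes _ = cong₂ _+ℚ_ (toℚ-/ (x (suc N)) N) (divRecSumUpTo-≡ N n x)
... | no  _ = trans (divRecSumUpTo-≡ N n x) (sym (ℚₚ.+-identityˡ _))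

properDivRecSum-≡ : ∀ n x → properDivRecSum n x ≡ properDivisorSum n (weighted (toℚ ∘ x))
properDivRecSum-≡ zero    x = refl
properDivRecSum-≡ (suc n) x = divRecSumUpTo-≡ n (suc n) x

divSumUpTo-≡ : ∀ N q x → toℚ (divSumUpTo N q x) ≡ divSumTo N q (toℚ ∘ x)
divSumUpTo-≡ zero    q x = refl
divSumUpTo-≡ (suc N) q x with suc N ∣? q
... | yes _ = trans (toℚ-homo-+ (x (suc N)) (divSumUpTo N q x)) (cong (toℚ (x (suc N)) +ℚ_) (divSumUpTo-≡ N q x))
... | no  _ = trans (divSumUpTo-≡ N q x) (sym (ℚₚ.+-identityˡ _))

statementBound : ∀ c n → 2 ≤ n → (x : ℕ → ℕ) →
  ((p q : ℕ) → Prime p → n ≡ p * q → divSum q x ≤ c) → properDivRecSum n x ≤ℚ toℚ c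
statementBound c n 2≤n x bounded = subst (_≤ℚ toℚ c) (sym (properDivRecSum-≡ n x))
  (upperBound (toℚ c) n 2≤n (toℚ ∘ x) (λ d → toℚ-nonNeg (x d))
    (λ p q pr n≡pq → subst (_≤ℚ toℚ c) (divSumUpTo-≡ q q x) (toℚ-mono-≤ (bounded p q pr n≡pq))))

atOneℕ : ℕ → ℕ → ℕ
atOneℕ c 1 = c
atOneℕ c _ = 0

divSumUpTo-atOneℕ : ∀ N q c → divSumUpTo N q (atOneℕ c) ≤ c
divSumUpTo-atOneℕ zero    q c = z≤n
divSumUpTo-atOneℕ (suc N) q c with suc N ∣? q
... | yes _ = add-top N (divSumUpTo-atOneℕ N q c)
  where
  -- only the index 1 contributes
  add-top : ∀ N → divSumUpTo N q (atOneℕ c) ≤ c → atOneℕ c (suc N) ℕ.+ divSumUpTo N q (atOneℕ c) ≤ c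
  add-top zero    _ = ℕₚ.≤-reflexive (ℕₚ.+-identityʳ c)
  add-top (suc N) h = h
... | no  _ = divSumUpTo-atOneℕ N q c

atOneℕ-attains : ∀ c n → 2 ≤ n → properDivRecSum n (atOneℕ c) ≡ toℚ c
atOneℕ-attains c (suc zero)        (s≤s ())
atOneℕ-attains c n@(suc (suc n')) _ = begin
  properDivRecSum n (atOneℕ c)                    ≡⟨ properDivRecSum-≡ n (atOneℕ c) ⟩
  properDivisorSum n (weighted (toℚ ∘ atOneℕ c))  ≡⟨ divSumTo-cong (suc n') n (λ d _ → termwise d) ⟩
  properDivisorSum n (atOne (toℚ c))              ≡⟨ divSumTo-atOne n' n (toℚ c) ⟩
  toℚ c                                           ∎
  where
  open ≡-Reasoning
  termwise : ∀ d → weighted (toℚ ∘ atOneℕ c) (suc d) ≡ atOne (toℚ c) (suc d)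
  termwise zero    = ℚₚ.*-identityʳ (toℚ c)
  termwise (suc d) = ℚₚ.*-zeroˡ (recip (suc (suc d)))

-- The bound m - 1 holds (statementBound) and is attained by (m - 1)·δ₁.
lemma5p2 : (m n : ℕ) → 1 ≤ m → 2 ≤ n →
    ((x : ℕ → ℕ) →
      ((p q : ℕ) → Prime p → n ≡ p * q → divSum q x ≤ m ∸ 1) →
      properDivRecSum n x ≤ℚ ((+ (m ∸ 1)) / 1))
    × Σ (ℕ → ℕ) (λ x →
      ((p q : ℕ) → Prime p → n ≡ p * q → divSum q x ≤ m ∸ 1) ×
      (properDivRecSum n x ≡ ((+ (m ∸ 1)) / 1)))
lemma5p2 m n _ 2≤n =
    statementBound (m ∸ 1) n 2≤n
  , atOneℕ (m ∸ 1)
  , (λ _ q _ _ → divSumUpTo-atOneℕ q q (m ∸ 1))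
  , atOneℕ-attains (m ∸ 1) n 2≤n
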